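{- Let $(U,\varphi)$ be a hypergraph, $\varphi^{*}=\lnot\varphi\cap\left(1'\cup\varphi^{ -1}\right)$ its dual relation, and $v\in U$ a vertex, i.e. $(v,v)\in\varphi$. Then \[ \left\{ s\in U:\,(s,s)\in\varphi\land\left(\exists w\in U:(w,s)\in\varphi\land(w,v)\in\varphi\land(w,w)\notin\varphi\right)\right\} =\left\{ s\in U:\,(s,s)\in\varphi\land(s,v)\in\varphi\circ\varphi^{*}\right\}, \] and this set is the neighborhood $\Gamma(v)$ of $v$, i.e. the set of vertices belonging to the hyperedges that contain $v$.
   Context: A hypergraph (relational definition) is a set $U$ with a binary relation $\varphi\subseteq U\times U$ such that: (1) $(x,y)\in\varphi\implies(y,y)\in\varphi$; (2) $(x,y)\in\varphi\land(y,z)\in\varphi\implies y=z$. Vertices are $V=\{v\in U:(v,v)\in\varphi\}$, hyperedges are $E=\{e\in U:(e,e)\notin\varphi\}$, and a hyperedge $e$ contains $v$ iff $(e,v)\in\varphi$. Notation: $\lnot\varphi$ is the complement relation on $U$, $1'$ the identity relation on $U$, $\varphi^{ -1}$ the converse relation ($(x,y)\in\varphi^{ -1}\Leftrightarrow(y,x)\in\varphi$), and $\circ$ composition of relations. $(U,\varphi^{*})$ is the dual hypergraph. -}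

module Defs where

open import Data.Product using (_×_; ∃-syntax)
open import Data.Sum using (_⊎_)
open import Relation.Nullary using (¬_)
open import Relation.Unary using (Pred)
open import Relation.Binary.PropositionalEquality using (_≡_)

Rel₂ : Set → Set₁
Rel₂ U = U → U → Set

record IsHypergraph {U : Set} (φ : Rel₂ U) : Set where
  field
    refl-target : ∀ {x y} → φ x y → φ y y
    collapse    : ∀ {x y z} → φ x y → φ y z → y ≡ z

∁ᵣ : {U : Set} → Rel₂ U → Rel₂ U
∁ᵣ φ x y = ¬ φ x y

1′ : {U : Set} → Rel₂ U
1′ x y = x ≡ y

_⁻¹ᵣ : {U : Set} → Rel₂ U → Rel₂ U
(φ ⁻¹ᵣ) x y = φ y x

_∩ᵣ_ : {U : Set} → Rel₂ U → Rel₂ U → Rel₂ U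
(R ∩ᵣ S) x y = R x y × S x y

_∪ᵣ_ : {U : Set} → Rel₂ U → Rel₂ U → Rel₂ U
(R ∪ᵣ S) x y = R x y ⊎ S x y

-- Composition, in functional order: (x,z) ∈ R ∘ S  iff  ∃ y, (x,y) ∈ S ∧ (y,z) ∈ R.
_∘ᵣ_ : {U : Set} → Rel₂ U → Rel₂ U → Rel₂ U
(R ∘ᵣ S) x z = ∃[ y ] (S x y × R y z)

dual : {U : Set} → Rel₂ U → Rel₂ U
dual φ = ∁ᵣ φ ∩ᵣ (1′ ∪ᵣ (φ ⁻¹ᵣ))

IsVertex : {U : Set} → Rel₂ U → Pred U _
IsVertex φ v = φ v v

IsEdge : {U : Set} → Rel₂ U → Pred U _
IsEdge φ e = ¬ φ e e

Contains : {U : Set} → Rel₂ U → U → U → Set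
Contains φ e v = φ e v

Γ : {U : Set} → Rel₂ U → U → Pred U _
Γ φ v s = IsVertex φ s × ∃[ e ] (IsEdge φ e × Contains φ e v × Contains φ e s)

module Submission where

open import Defs
open import Data.Product using (_×_; ∃-syntax; _,_; map₂)
open import Data.Sum using (inj₁; inj₂)
open import Relation.Nullary using (¬_; contradiction)
open import Relation.Unary using (_≐_)
open import Relation.Binary.PropositionalEquality using (subst)

module _ {U : Set} {φ : Rel₂ U} (hyp : IsHypergraph φ) where
  open IsHypergraph hyp

  edge-not-contained-in-vertex : ∀ {e s} → IsEdge φ e → φ e s → ¬ φ s e
  edge-not-contained-in-vertex ¬ee es se =
    ¬ee (subst (λ z → φ z z) (collapse es se) (refl-target es))

  dual-of-edge : ∀ {e s} → IsEdge φ e → φ e s → dual φ s e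
  dual-of-edge ¬ee es = edge-not-contained-in-vertex ¬ee es , inj₂ es

  -- A vertex is related to itself, so the 1′ branch of φ* is impossible at a vertex.
  dual-from-vertex : ∀ {s e} → IsVertex φ s → dual φ s e → IsEdge φ e × φ e s
  dual-from-vertex ss (¬se , inj₁ s≡e) = contradiction (subst (φ _) s≡e ss) ¬se
  dual-from-vertex ss (¬se , inj₂ es) =
    (λ ee → ¬se (subst (λ z → φ z _) (collapse ee es) ee)) , es

  shares-edge⇒∘dual : ∀ {s v} → ∃[ w ] (φ w s × φ w v × IsEdge φ w) → (φ ∘ᵣ dual φ) s v
  shares-edge⇒∘dual (w , ws , wv , ¬ww) = w , dual-of-edge ¬ww ws , wv

  ∘dual⇒shares-edge : ∀ {s v} → IsVertex φ s → (φ ∘ᵣ dual φ) s v →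
                      ∃[ w ] (φ w s × φ w v × IsEdge φ w)
  ∘dual⇒shares-edge ss (w , sw* , wv) with dual-from-vertex ss sw*
  ... | ¬ww , ws = w , ws , wv , ¬ww

mainTheorem5 : {U : Set} (φ : Rel₂ U) → IsHypergraph φ → (v : U) → φ v v →
    ((λ s → φ s s × ∃[ w ] (φ w s × φ w v × ¬ φ w w))
      ≐ (λ s → φ s s × (φ ∘ᵣ dual φ) s v))
    × ((λ s → φ s s × ∃[ w ] (φ w s × φ w v × ¬ φ w w)) ≐ Γ φ v)
mainTheorem5 φ hyp v _ =
  (map₂ (shares-edge⇒∘dual hyp) , λ (ss , s∘v) → ss , ∘dual⇒shares-edge hyp ss s∘v)
  , (map₂ reorder , map₂ reorder⁻¹)
  where
  reorder : ∀ {s} → ∃[ w ] (φ w s × φ w v × ¬ φ w w) → ∃[ e ] (IsEdge φ e × φ e v × φ e s)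
  reorder (w , ws , wv , ¬ww) = w , ¬ww , wv , ws
  reorder⁻¹ : ∀ {s} → ∃[ e ] (IsEdge φ e × φ e v × φ e s) → ∃[ w ] (φ w s × φ w v × ¬ φ w w)
  reorder⁻¹ (e , ¬ee , ev , es) = e , es , ev , ¬ee
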